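{- Let $C>0$, let $k\ge 1$ be an integer, let $0<T<C/k$, and set $r=kT/C$. Then for every transaction sequence $\mathsf{Tx}$ with all values at most $T$, \[ V^{\mathrm{gen}}_{\mathrm{OPT}}(\mathsf{Tx}) \le \frac{k+1}{k(1-r)}\, V^{k\text{ -wallet}}_{\textsc{FlushWhenFull}}(\mathsf{Tx}), \] where the left side is the value settled by the optimal offline policy in the general collateral model with total collateral $C$, and the right side is the value settled by $\textsc{FlushWhenFull}$ operating in the discrete $k$-wallet model with total collateral $C$.
   Context: Transactions: time is divided into discrete slots $t=1,2,\dots$; a transaction sequence $\mathsf{Tx}=(\mathsf{tx}_1,\dots,\mathsf{tx}_n)$ has $\mathsf{tx}_t\in[0,T]$ the value of the transaction arriving at slot $t$ (value $0$ = no transaction). Each arriving transaction must immediately be settled (by committing available collateral equal to its value) or discarded. Committed collateral becomes available again only via a flush: collateral flushed at time $t$ is unavailable during $(t,t+F]$ and available again afterwards ($F$ a fixed positive integer). General collateral model $\mathcal{M}^{C}_T$: a single pool of total collateral $C$; a transaction of value $v$ can be settled iff at least $v$ collateral is currently available (neither committed-unflushed nor in a flush period); any portion of committed collateral may be flushed at any time. $V^{\mathrm{gen}}_{\mathrm{OPT}}(\mathsf{Tx})$ is the maximum total settled value achievable in this model by any policy with full knowledge of $\mathsf{Tx}$. Discrete $k$-wallet model: the collateral $C$ is split into $k$ wallets of capacity $C/k$; a transaction is settled from a single online wallet whose available collateral $R$ is at least its value $v$ (leaving $R-v$); a whole wallet is flushed at once, going offline during $(t,t+F]$ and then returning with available collateral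 $C/k$. Algorithm $\textsc{FlushWhenFull}$ (in the $k$-wallet model): the wallets are used one at a time in a fixed cyclic order. The active wallet settles each arriving transaction as long as it fits. When a transaction arrives that does not fit in the active wallet, that wallet is immediately flushed and the next wallet in cyclic order becomes active (handling the transaction if it is online); if the next wallet is still offline, the algorithm waits for it to come back online, discarding all transactions arriving during this wait.
   Formalization: The total collateral $C$, the bound $T$, the transaction values and the amounts of collateral flushed by a policy in the general model are rational instead of real. -}

module Defs where

open import Data.Bool using (Bool; true; false; if_then_else_; _∧_)
open import Data.Nat as ℕ using (ℕ; zero; suc; _∸_) renaming (_+_ to _+ℕ_; _≤ᵇ_ to _≤ᵇℕ_)
open import Data.Integer using (+_)
open import Data.Rational using (ℚ; 0ℚ; _+_; _-_; _*_; _/_; _≤ᵇ_) renaming (_≤_ to _≤q_)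
open import Data.List using (List; []; _∷_; _++_; [_]; replicate; length)
open import Data.Product using (_×_; _,_)
open import Relation.Binary.PropositionalEquality using (_≡_)

-- Conventions.  Slots are numbered 0,1,2,… (slot t here is slot t+1 of
-- the paper).  A transaction sequence is a finite list of values; the
-- value at a slot beyond its end is 0 (no transaction).

txAt : List ℚ → ℕ → ℚ
txAt []       _       = 0ℚ
txAt (v ∷ vs) zero    = v
txAt (v ∷ vs) (suc t) = txAt vs t

sumBelow : (ℕ → ℚ) → ℕ → ℚ
sumBelow f zero    = 0ℚ
sumBelow f (suc t) = sumBelow f t + f t

sumRange : (ℕ → ℚ) → ℕ → ℕ → ℚ
sumRange f a zero    = 0ℚ
sumRange f a (suc b) = if a ≤ᵇℕ b then sumRange f a b + f b else sumRange f a b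

-- A policy decides at each slot whether to settle the arriving
-- transaction and how much committed collateral to flush (after the
-- settlement decision of that slot).

record GenPolicy : Set where
  field
    settle : ℕ → Bool
    flush  : ℕ → ℚ
open GenPolicy public

settledAt : List ℚ → GenPolicy → ℕ → ℚ
settledAt Tx σ t = if settle σ t then txAt Tx t else 0ℚ

committedBefore : List ℚ → GenPolicy → ℕ → ℚ
committedBefore Tx σ t = sumBelow (settledAt Tx σ) t - sumBelow (flush σ) t

-- collateral in a flush period during slot t: flushed at s with s < t ≤ s + F
inFlush : ℕ → GenPolicy → ℕ → ℚ
inFlush F σ t = sumRange (flush σ) (t ∸ F) t

record FeasibleGen (C : ℚ) (F : ℕ) (Tx : List ℚ) (σ : GenPolicy) : Set where
  field
    flush-nonneg : ∀ t → 0ℚ ≤q flush σ t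
    flush-committed : ∀ t → sumBelow (flush σ) (suc t)
                            ≤q sumBelow (settledAt Tx σ) (suc t)
    settle-available : ∀ t → settle σ t ≡ true →
      txAt Tx t ≤q (C - committedBefore Tx σ t) - inFlush F σ t

genValue : List ℚ → GenPolicy → ℚ
genValue Tx σ = sumBelow (settledAt Tx σ) (length Tx)

-- A wallet records its available collateral and the first slot at which it
-- is online (a wallet flushed at slot t is offline during (t, t+F] and
-- returns at slot t+F+1 with full capacity).
-- The wallets are kept in a list in cyclic order, the active wallet first;
-- moving to the next wallet rotates the active one to the end.

record Wallet : Set where
  constructor mkWallet
  field
    avail    : ℚ
    onlineAt : ℕ
open Wallet public

online : ℕ → Wallet → Bool
online t w = onlineAt w ≤ᵇℕ t

tryActive : ℕ → ℚ → List Wallet → ℚ × List Wallet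
tryActive t v []       = 0ℚ , []
tryActive t v (w ∷ ws) =
  if online t w ∧ (v ≤ᵇ avail w)
  then (v , mkWallet (avail w - v) (onlineAt w) ∷ ws)
  else (0ℚ , w ∷ ws)

fwfStep : ℚ → ℕ → ℕ → ℚ → List Wallet → ℚ × List Wallet
fwfStep cap F t v []       = 0ℚ , []
fwfStep cap F t v (w ∷ ws) =
  if online t w
  then (if v ≤ᵇ avail w
        then (v , mkWallet (avail w - v) (onlineAt w) ∷ ws)
        else tryActive t v (ws ++ [ mkWallet cap (suc (t +ℕ F)) ]))
  else (0ℚ , w ∷ ws)   -- waiting for the active wallet: discard

fwfRun : ℚ → ℕ → ℕ → List ℚ → List Wallet → ℚ
fwfRun cap F t []       ws = 0ℚ
fwfRun cap F t (v ∷ vs) ws with fwfStep cap F t v ws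
... | (a , ws') = a + fwfRun cap F (suc t) vs ws'

walletCap : (C : ℚ) (k : ℕ) → .{{_ : ℕ.NonZero k}} → ℚ
walletCap C k = C * ((+ 1) / k)

fwfValue : (C : ℚ) (k : ℕ) → .{{_ : ℕ.NonZero k}} → (F : ℕ) → List ℚ → ℚ
fwfValue C k F Tx = fwfRun (walletCap C k) F 0 Tx (replicate k (mkWallet (walletCap C k) 0))

-- Let P t be the value a feasible general policy settles before slot t.  Collateral flushed
-- after slot t ∸ F is still unavailable at slot t, so P (t + 1) ≤ C + P f whenever t ≤ f + F
-- (settled-window).  FlushWhenFull only discards transactions while it waits for a wallet
-- flushed at some slot f, so it suffices to control k·(C + P f) for the wallets in its queue.
-- With cap = C/k, Q the value of FlushWhenFull, n its number of flushes and B the value held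
-- by the wallets flushed so far, the invariant is
--   k·P t ≤ k·Q + n·e   and   n·(cap − T) ≤ B ≤ Q,   where e = cap + (k − 1)·T,
-- the second because a wallet is flushed only when a transaction of value ≤ T does not fit.
-- The wallet i places behind the active one was flushed at a slot f with
-- k·(C + P f) ≤ k·B + n·e + i·D, where D = k·(cap − T) + e.  A flush raises k·B + n·e by at
-- least D, moving every queued wallet one place forward, and e is exactly what makes
-- k·C = e + (k − 1)·D, so the wallet just flushed fits at the back of the queue.
-- Eliminating n gives k·(cap − T)·P ≤ D·Q = ((k + 1)·cap − T)·Q ≤ (k + 1)·cap·Q.

{-# OPTIONS --safe #-}
module Submission where

open import Defs
open import Data.Bool using (true; false; T)
open import Data.Empty using (⊥; ⊥-elim)
open import Data.Integer using (+_)
import Data.Integer as ℤ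
import Data.Integer.Properties as ℤ
open import Data.List using (List; []; _∷_; _++_; [_]; length; replicate)
import Data.List.Properties as List
open import Data.List.Relation.Unary.All using (All; []; _∷_)
open import Data.Nat as ℕ using (ℕ; zero; suc; _∸_; _≤′_; ≤′-refl; ≤′-step)
  renaming (_+_ to _+ℕ_; _≤_ to _≤ℕ_)
import Data.Nat.Properties as ℕ
open import Data.Product using (_×_; _,_; proj₁; proj₂; ∃-syntax)
open import Data.Rational hiding (truncate)
open import Data.Rational.Properties
import Data.Rational.Unnormalised as ℚᵘ
import Data.Rational.Unnormalised.Properties as ℚᵘ
open import Data.Sum using (_⊎_; inj₁; inj₂)
open import Data.Unit using (⊤; tt)
open import Function using (_∘_)
open import Relation.Binary.PropositionalEquality hiding ([_])
open import Relation.Nullary using (¬_)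
open import Relation.Nullary.Decidable using (dec⇒maybe)
open import Relation.Nullary.Reflects using (Reflects; ofʸ; ofⁿ; fromEquivalence)
open import Tactic.RingSolver using (solve-∀)
open import Tactic.RingSolver.Core.AlmostCommutativeRing using (AlmostCommutativeRing; fromCommutativeRing)

ℚ-ring : AlmostCommutativeRing _ _
ℚ-ring = fromCommutativeRing +-*-commutativeRing (λ p → dec⇒maybe (0ℚ ≟ p))

ι : ℕ → ℚ
ι n = + n / 1

toℚᵘ-ι : ∀ n → toℚᵘ (ι n) ℚᵘ.≃ ℚᵘ.mkℚᵘ (+ n) 0
toℚᵘ-ι n = toℚᵘ-fromℚᵘ (ℚᵘ.mkℚᵘ (+ n) 0)

ι-suc : ∀ n → ι (suc n) ≡ 1ℚ + ι n
ι-suc n = toℚᵘ-injective (begin-equality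
  toℚᵘ (ι (suc n))                ≃⟨ toℚᵘ-ι (suc n) ⟩
  ℚᵘ.mkℚᵘ (+ suc n) 0             ≃⟨ ℚᵘ.*≡* ↥-equation ⟩
  toℚᵘ 1ℚ ℚᵘ.+ ℚᵘ.mkℚᵘ (+ n) 0    ≃⟨ ℚᵘ.+-congʳ (toℚᵘ 1ℚ) (toℚᵘ-ι n) ⟨
  toℚᵘ 1ℚ ℚᵘ.+ toℚᵘ (ι n)         ≃⟨ toℚᵘ-homo-+ 1ℚ (ι n) ⟨
  toℚᵘ (1ℚ + ι n)                 ∎)
  where
    open ℚᵘ.≤-Reasoning
    ↥-equation : + suc n ℤ.* + 1 ≡ (+ 1 ℤ.* + 1 ℤ.+ + n ℤ.* + 1) ℤ.* + 1
    ↥-equation = cong (λ m → (+ 1 ℤ.+ m) ℤ.* + 1) (sym (ℤ.*-identityʳ (+ n)))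

0≤ι : ∀ n → 0ℚ ≤ ι n
0≤ι n = nonNegative⁻¹ (ι n) {{normalize-nonNeg n 1}}

ι*1/ι≡1 : ∀ n .{{_ : ℕ.NonZero n}} → ι n * (+ 1 / n) ≡ 1ℚ
ι*1/ι≡1 (suc n) = toℚᵘ-injective (begin-equality
  toℚᵘ (ι (suc n) * (+ 1 / suc n))           ≃⟨ toℚᵘ-homo-* (ι (suc n)) (+ 1 / suc n) ⟩
  toℚᵘ (ι (suc n)) ℚᵘ.* toℚᵘ (+ 1 / suc n)   ≃⟨ ℚᵘ.*-cong (toℚᵘ-ι (suc n)) (toℚᵘ-fromℚᵘ (ℚᵘ.mkℚᵘ (+ 1) n)) ⟩
  m ℚᵘ.* ℚᵘ.1/ m                             ≃⟨ ℚᵘ.*-inverseʳ m ⟩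
  toℚᵘ 1ℚ                                    ∎)
  where
    open ℚᵘ.≤-Reasoning
    m : ℚᵘ.ℚᵘ
    m = ℚᵘ.mkℚᵘ (+ suc n) 0

p≤p+q : ∀ {p q} → 0ℚ ≤ q → p ≤ p + q
p≤p+q {p} 0≤q = ≤-trans (≤-reflexive (sym (+-identityʳ p))) (+-monoʳ-≤ p 0≤q)

p-q≤p : ∀ {p q} → 0ℚ ≤ q → p - q ≤ p
p-q≤p {p} 0≤q = ≤-trans (+-monoʳ-≤ p (neg-antimono-≤ 0≤q)) (≤-reflexive (+-identityʳ p))

p≤q⇒0≤q-p : ∀ {p q} → p ≤ q → 0ℚ ≤ q - p
p≤q⇒0≤q-p {p} p≤q = ≤-trans (≤-reflexive (sym (+-inverseʳ p))) (+-monoˡ-≤ (- p) p≤q)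

0≤p*q : ∀ {p q} → 0ℚ ≤ p → 0ℚ ≤ q → 0ℚ ≤ p * q
0≤p*q {p} {q} 0≤p 0≤q =
  nonNegative⁻¹ (p * q) {{nonNeg*nonNeg⇒nonNeg p {{nonNegative 0≤p}} q {{nonNegative 0≤q}}}}

≤ᵇ-reflects-≤ : ∀ p q → Reflects (p ≤ q) (p ≤ᵇ q)
≤ᵇ-reflects-≤ p q = fromEquivalence ≤ᵇ⇒≤ ≤⇒≤ᵇ

*-÷-cancel : ∀ a b c t .{{_ : NonZero c}} → b * a ≡ c → a * ((b * t) ÷ c) ≡ t
*-÷-cancel a b c t b*a≡c = begin
  a * ((b * t) * 1/ c)  ≡⟨ rearrange a b t (1/ c) ⟩
  t * ((b * a) * 1/ c)  ≡⟨ cong (λ z → t * (z * 1/ c)) b*a≡c ⟩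
  t * (c * 1/ c)        ≡⟨ cong (t *_) (*-inverseʳ c) ⟩
  t * 1ℚ                ≡⟨ *-identityʳ t ⟩
  t                     ∎
  where
    open ≡-Reasoning
    rearrange : ∀ a b t i → a * ((b * t) * i) ≡ t * ((b * a) * i)
    rearrange = solve-∀ ℚ-ring

All-txAt : ∀ {P : ℚ → Set} {Tx} → P 0ℚ → All P Tx → ∀ t → P (txAt Tx t)
All-txAt P0 []         t       = P0
All-txAt P0 (Pv ∷ _)   zero    = Pv
All-txAt P0 (_ ∷ Pvs)  (suc t) = All-txAt P0 Pvs t

sumBelow-mono : ∀ {f} → (∀ t → 0ℚ ≤ f t) → ∀ {a b} → a ≤ℕ b → sumBelow f a ≤ sumBelow f b
sumBelow-mono {f} 0≤f a≤b = go (ℕ.≤⇒≤′ a≤b)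
  where
    go : ∀ {a b} → a ≤′ b → sumBelow f a ≤ sumBelow f b
    go ≤′-refl       = ≤-refl
    go (≤′-step a≤b) = ≤-trans (go a≤b) (p≤p+q (0≤f _))

sumRange-empty : ∀ f a b → b ≤ℕ a → sumRange f a b ≡ 0ℚ
sumRange-empty f a zero    _     = refl
sumRange-empty f a (suc b) b<a with a ℕ.≤ᵇ b in a≤ᵇb
... | true  = ⊥-elim (ℕ.<⇒≱ b<a (ℕ.≤ᵇ⇒≤ a b (subst T (sym a≤ᵇb) _)))
... | false = sumRange-empty f a b (ℕ.<⇒≤ b<a)

sumRange-suc : ∀ f {a b} → a ≤ℕ b → sumRange f a (suc b) ≡ sumRange f a b + f b
sumRange-suc f {a} {b} a≤b with a ℕ.≤ᵇ b | ℕ.≤⇒≤ᵇ a≤b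
... | true | _ = refl

sumBelow-split : ∀ f {a b} → a ≤ℕ b → sumBelow f b ≡ sumBelow f a + sumRange f a b
sumBelow-split f {a} a≤b = go (ℕ.≤⇒≤′ a≤b)
  where
    go : ∀ {b} → a ≤′ b → sumBelow f b ≡ sumBelow f a + sumRange f a b
    go ≤′-refl = begin
      sumBelow f a                  ≡⟨ +-identityʳ _ ⟨
      sumBelow f a + 0ℚ             ≡⟨ cong (_+_ (sumBelow f a)) (sumRange-empty f a a ℕ.≤-refl) ⟨
      sumBelow f a + sumRange f a a ∎
      where open ≡-Reasoning
    go {suc b} (≤′-step a≤′b) = begin
      sumBelow f b + f b                        ≡⟨ cong (_+ f b) (go a≤′b) ⟩
      sumBelow f a + sumRange f a b + f b       ≡⟨ +-assoc (sumBelow f a) _ _ ⟩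
      sumBelow f a + (sumRange f a b + f b)
        ≡⟨ cong (_+_ (sumBelow f a)) (sumRange-suc f (ℕ.≤′⇒≤ a≤′b)) ⟨
      sumBelow f a + sumRange f a (suc b)       ∎
      where open ≡-Reasoning

module FeasiblePolicy (C : ℚ) (F : ℕ) (Tx : List ℚ) (σ : GenPolicy) (feasible : FeasibleGen C F Tx σ)
                    (0≤C : 0ℚ ≤ C) (0≤txAt : ∀ t → 0ℚ ≤ txAt Tx t) where

  open FeasibleGen feasible

  settled : ℕ → ℚ
  settled = sumBelow (settledAt Tx σ)

  flushed : ℕ → ℚ
  flushed = sumBelow (flush σ)

  settledAt≤txAt : ∀ t → settledAt Tx σ t ≤ txAt Tx t
  settledAt≤txAt t with settle σ t
  ... | true  = ≤-refl
  ... | false = 0≤txAt t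

  0≤settledAt : ∀ t → 0ℚ ≤ settledAt Tx σ t
  0≤settledAt t with settle σ t
  ... | true  = 0≤txAt t
  ... | false = ≤-refl

  settled-step : ∀ t → settled (suc t) ≤ settled t + txAt Tx t
  settled-step t = +-monoʳ-≤ (settled t) (settledAt≤txAt t)

  settled-mono : ∀ {a b} → a ≤ℕ b → settled a ≤ settled b
  settled-mono = sumBelow-mono 0≤settledAt

  flushed-mono : ∀ {a b} → a ≤ℕ b → flushed a ≤ flushed b
  flushed-mono = sumBelow-mono flush-nonneg

  flushed≤settled : ∀ t → flushed t ≤ settled t
  flushed≤settled zero    = ≤-refl
  flushed≤settled (suc t) = flush-committed t

  settled≤C+flushed : ∀ t → settled t ≤ C + flushed (t ∸ F)
  settled-suc≤C+flushed : ∀ t → settled (suc t) ≤ C + flushed (t ∸ F)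

  settled≤C+flushed zero rewrite ℕ.0∸n≡0 F = ≤-trans 0≤C (≤-reflexive (sym (+-identityʳ C)))
  settled≤C+flushed (suc t) =
    ≤-trans (settled-suc≤C+flushed t) (+-monoʳ-≤ C (flushed-mono (ℕ.∸-monoˡ-≤ F (ℕ.n≤1+n t))))

  settled-suc≤C+flushed t with settle σ t in settles
  ... | false = ≤-trans (≤-reflexive (+-identityʳ (settled t))) (settled≤C+flushed t)
  ... | true  = begin
    settled t + txAt Tx t                       ≤⟨ +-monoʳ-≤ (settled t) (settle-available t settles) ⟩
    settled t + ((C - (settled t - flushed t)) - R)
      ≡⟨ cong (λ f → settled t + ((C - (settled t - f)) - R)) (sumBelow-split (flush σ) (ℕ.m∸n≤m t F)) ⟩
    settled t + ((C - (settled t - (flushed (t ∸ F) + R))) - R) ≡⟨ cancel (settled t) C (flushed (t ∸ F)) R ⟩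
    C + flushed (t ∸ F)                          ∎
    where
      open ≤-Reasoning
      R : ℚ
      R = inFlush F σ t
      cancel : ∀ s c a r → s + ((c - (s - (a + r))) - r) ≡ c + a
      cancel = solve-∀ ℚ-ring

  settled-window : ∀ f t → t ≤ℕ f +ℕ F → settled (suc t) ≤ C + settled f
  settled-window f t t≤f+F = ≤-trans (settled-suc≤C+flushed t)
    (+-monoʳ-≤ C (≤-trans (flushed≤settled (t ∸ F)) (settled-mono t∸F≤f)))
    where
      t∸F≤f : t ∸ F ≤ℕ f
      t∸F≤f = ℕ.m≤n+o⇒m∸n≤o t F (subst (t ≤ℕ_) (ℕ.+-comm f F) t≤f+F)

fwfRun-∷ : ∀ cap F t v vs ws →
  fwfRun cap F t (v ∷ vs) ws
    ≡ proj₁ (fwfStep cap F t v ws) + fwfRun cap F (suc t) vs (proj₂ (fwfStep cap F t v ws))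
fwfRun-∷ cap F t v vs ws with fwfStep cap F t v ws
... | _ = refl

module FlushWhenFull
  (C cap T : ℚ) (k′ F : ℕ) (x P : ℕ → ℚ)
  (k*cap≡C : ι (suc k′) * cap ≡ C) (0<cap : 0ℚ < cap) (0≤T : 0ℚ ≤ T) (T≤cap : T ≤ cap)
  (0≤x : ∀ t → 0ℚ ≤ x t) (x≤T : ∀ t → x t ≤ T)
  (P-zero : P 0 ≡ 0ℚ) (P-step : ∀ t → P (suc t) ≤ P t + x t)
  (P-window : ∀ f t → t ≤ℕ f +ℕ F → P (suc t) ≤ C + P f)
  where

  k : ℚ
  k = ι (suc k′)

  e : ℚ
  e = cap + ι k′ * T

  D : ℚ
  D = k * (cap - T) + e

  instance
    k-nonNeg : NonNegative k
    k-nonNeg = nonNegative (0≤ι (suc k′))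

    cap-T-nonNeg : NonNegative (cap - T)
    cap-T-nonNeg = nonNegative (p≤q⇒0≤q-p T≤cap)

    e-nonNeg : NonNegative e
    e-nonNeg = nonNegative (+-mono-≤ (≤-trans 0≤T T≤cap) (0≤p*q (0≤ι k′) 0≤T))

  k*C≡e+k′*D : k * C ≡ e + ι k′ * D
  k*C≡e+k′*D = begin
    k * C                  ≡⟨ cong (k *_) k*cap≡C ⟨
    k * (k * cap)          ≡⟨ cong (λ k → k * (k * cap)) (ι-suc k′) ⟩
    (1ℚ + j) * ((1ℚ + j) * cap) ≡⟨ identity j cap T ⟩
    (cap + j * T) + j * ((1ℚ + j) * (cap - T) + (cap + j * T))
                           ≡⟨ cong (λ k → e + j * (k * (cap - T) + e)) (ι-suc k′) ⟨
    e + j * D              ∎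
    where
      open ≡-Reasoning
      j : ℚ
      j = ι k′
      identity : ∀ j c t → (1ℚ + j) * ((1ℚ + j) * c) ≡ (c + j * t) + j * ((1ℚ + j) * (c - t) + (c + j * t))
      identity = solve-∀ ℚ-ring

  D≡[1+k]*cap-T : D ≡ (1ℚ + k) * cap - T
  D≡[1+k]*cap-T = begin
    k * (cap - T) + (cap + j * T)           ≡⟨ cong (λ k → k * (cap - T) + (cap + j * T)) (ι-suc k′) ⟩
    (1ℚ + j) * (cap - T) + (cap + j * T)    ≡⟨ identity j cap T ⟩
    (1ℚ + (1ℚ + j)) * cap - T               ≡⟨ cong (λ k → (1ℚ + k) * cap - T) (ι-suc k′) ⟨
    (1ℚ + k) * cap - T                      ∎
    where
      open ≡-Reasoning
      j : ℚ
      j = ι k′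
      identity : ∀ j c t → (1ℚ + j) * (c - t) + (c + j * t) ≡ (1ℚ + (1ℚ + j)) * c - t
      identity = solve-∀ ℚ-ring

  used : Wallet → ℚ
  used w = cap - avail w

  threshold : ℕ → ℚ → ℚ
  threshold n B = k * B + ι n * e

  threshold-suc : ∀ n B → threshold (suc n) B ≡ threshold n B + e
  threshold-suc n B = begin
    k * B + ι (suc n) * e       ≡⟨ cong (λ m → k * B + m * e) (ι-suc n) ⟩
    k * B + (1ℚ + ι n) * e      ≡⟨ rearrange (k * B) (ι n) e ⟩
    k * B + ι n * e + e         ∎
    where
      open ≡-Reasoning
      rearrange : ∀ a m e → a + (1ℚ + m) * e ≡ a + m * e + e
      rearrange = solve-∀ ℚ-ring

  threshold-+ : ∀ n B v → threshold n (B + v) ≡ threshold n B + k * v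
  threshold-+ n B v = rearrange k B v (ι n * e)
    where
      rearrange : ∀ k b v c → k * (b + v) + c ≡ k * b + c + k * v
      rearrange = solve-∀ ℚ-ring

  threshold-monoʳ : ∀ n {B B′} → B ≤ B′ → threshold n B ≤ threshold n B′
  threshold-monoʳ n B≤B′ = +-monoˡ-≤ (ι n * e) (*-monoˡ-≤-nonNeg k B≤B′)

  WaitBound : ℚ → Wallet → Set
  WaitBound V w = onlineAt w ≡ 0 ⊎ ∃[ f ] onlineAt w ≡ suc (f +ℕ F) × k * (C + P f) ≤ V

  Queue : ℚ → List Wallet → Set
  Queue V []       = ⊤
  Queue V (w ∷ ws) = avail w ≡ cap × WaitBound V w × Queue (V + D) ws

  WaitBound-mono : ∀ {V V′} w → V ≤ V′ → WaitBound V w → WaitBound V′ w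
  WaitBound-mono w V≤V′ (inj₁ fresh)               = inj₁ fresh
  WaitBound-mono w V≤V′ (inj₂ (f , returns , bound)) = inj₂ (f , returns , ≤-trans bound V≤V′)

  Queue-mono : ∀ {V V′} ws → V ≤ V′ → Queue V ws → Queue V′ ws
  Queue-mono []       V≤V′ _                      = tt
  Queue-mono (w ∷ ws) V≤V′ (full , wait , queue) =
    full , WaitBound-mono w V≤V′ wait , Queue-mono ws (+-monoˡ-≤ D V≤V′) queue

  Queue-snoc : ∀ {V} ws w → Queue V ws → avail w ≡ cap → WaitBound (V + ι (length ws) * D) w →
               Queue V (ws ++ [ w ])
  Queue-snoc {V} []        w _ full wait = full , WaitBound-mono w (≤-reflexive V+0*D≡V) wait , tt
    where
      V+0*D≡V : V + 0ℚ * D ≡ V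
      V+0*D≡V = trans (cong (_+_ V) (*-zeroˡ D)) (+-identityʳ V)
  Queue-snoc {V} (u ∷ us) w (full′ , wait′ , queue) full wait =
    full′ , wait′ , Queue-snoc us w queue full (WaitBound-mono w (≤-reflexive shift) wait)
    where
      shift : V + ι (suc (length us)) * D ≡ (V + D) + ι (length us) * D
      shift = trans (cong (λ m → V + m * D) (ι-suc (length us))) (rearrange V D (ι (length us)))
        where
          rearrange : ∀ v d m → v + (1ℚ + m) * d ≡ (v + d) + m * d
          rearrange = solve-∀ ℚ-ring

  Queue-replicate : ∀ {V} n → Queue V (replicate n (mkWallet cap 0))
  Queue-replicate zero    = tt
  Queue-replicate (suc n) = refl , inj₁ refl , Queue-replicate n

  wait-bound : ∀ {V} t w → WaitBound V w → ¬ onlineAt w ≤ℕ t → k * P (suc t) ≤ V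
  wait-bound t w (inj₁ fresh) offline = ⊥-elim (offline (subst (_≤ℕ t) (sym fresh) ℕ.z≤n))
  wait-bound t w (inj₂ (f , returns , bound)) offline =
    ≤-trans (*-monoˡ-≤-nonNeg k (P-window f t t≤f+F)) bound
    where
      t≤f+F : t ≤ℕ f +ℕ F
      t≤f+F = ℕ.s≤s⁻¹ (subst (t ℕ.<_) returns (ℕ.≰⇒> offline))

  record Invariant′ (t : ℕ) (w : Wallet) (queue : List Wallet) (Q : ℚ) : Set where
    field
      flushes       : ℕ
      banked        : ℚ
      Q≡banked+used : Q ≡ banked + used w
      0≤used        : 0ℚ ≤ used w
      queue-length  : length queue ≡ k′
      active-wait   : WaitBound (threshold flushes banked) w
      queue-wait    : Queue (threshold flushes banked + D) queue
      opt-bound     : k * P t ≤ threshold flushes Q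
      banked-full   : (cap - T) * ι flushes ≤ banked

    banked≤Q : banked ≤ Q
    banked≤Q = ≤-trans (p≤p+q 0≤used) (≤-reflexive (sym Q≡banked+used))

  Invariant : ℕ → List Wallet → ℚ → Set
  Invariant t []       Q = ⊥
  Invariant t (w ∷ ws) Q = Invariant′ t w ws Q

  After : ℕ → ℚ → ℚ × List Wallet → Set
  After t Q (a , ws) = Invariant (suc t) ws (Q + a)

  initial : Invariant 0 (replicate (suc k′) (mkWallet cap 0)) 0ℚ
  initial = record
    { flushes       = 0
    ; banked        = 0ℚ
    ; Q≡banked+used = sym (trans (+-identityˡ (cap - cap)) (+-inverseʳ cap))
    ; 0≤used        = ≤-reflexive (sym (+-inverseʳ cap))
    ; queue-length  = List.length-replicate k′
    ; active-wait   = inj₁ refl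
    ; queue-wait    = Queue-replicate k′
    ; opt-bound     = ≤-reflexive (begin
        k * P 0           ≡⟨ cong (k *_) P-zero ⟩
        k * 0ℚ            ≡⟨ +-identityʳ (k * 0ℚ) ⟨
        k * 0ℚ + 0ℚ       ≡⟨ cong (_+_ (k * 0ℚ)) (*-zeroˡ e) ⟨
        threshold 0 0ℚ    ∎)
    ; banked-full   = ≤-reflexive (*-zeroʳ (cap - T))
    }
    where open ≡-Reasoning

  opt-bound-step : ∀ {t Q} n → k * P t ≤ threshold n Q → k * P (suc t) ≤ threshold n (Q + x t)
  opt-bound-step {t} {Q} n opt = begin
    k * P (suc t)            ≤⟨ *-monoˡ-≤-nonNeg k (P-step t) ⟩
    k * (P t + x t)          ≡⟨ *-distribˡ-+ k (P t) (x t) ⟩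
    k * P t + k * x t        ≤⟨ +-monoˡ-≤ (k * x t) opt ⟩
    threshold n Q + k * x t  ≡⟨ threshold-+ n Q (x t) ⟨
    threshold n (Q + x t)    ∎
    where open ≤-Reasoning

  wait-step : ∀ {t w ws Q} → Invariant′ t w ws Q → ¬ onlineAt w ≤ℕ t → After t Q (0ℚ , w ∷ ws)
  wait-step {t} {w} {Q = Q} I offline = record
    { Invariant′ I hiding (Q≡banked+used; opt-bound; banked≤Q)
    ; Q≡banked+used = trans (+-identityʳ Q) Q≡banked+used
    ; opt-bound     = ≤-trans (wait-bound t w active-wait offline)
                              (threshold-monoʳ flushes (≤-trans banked≤Q (≤-reflexive (sym (+-identityʳ Q)))))
    }
    where open Invariant′ I

  settle-step : ∀ {t w ws Q} → Invariant′ t w ws Q → x t ≤ avail w →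
                After t Q (x t , mkWallet (avail w - x t) (onlineAt w) ∷ ws)
  settle-step {t} {w} {Q = Q} I fits = record
    { Invariant′ I hiding (Q≡banked+used; 0≤used; opt-bound; banked≤Q)
    ; Q≡banked+used = trans (cong (_+ x t) Q≡banked+used) (rearrange banked cap (avail w) (x t))
    ; 0≤used        = ≤-trans 0≤used (+-monoʳ-≤ cap (neg-antimono-≤ (p-q≤p (0≤x t))))
    ; opt-bound     = opt-bound-step flushes opt-bound
    }
    where
      open Invariant′ I
      rearrange : ∀ b c a v → b + (c - a) + v ≡ b + (c - (a - v))
      rearrange = solve-∀ ℚ-ring

  x≤cap : ∀ t → x t ≤ cap
  x≤cap t = ≤-trans (x≤T t) T≤cap

  activate : ∀ {t} L n Q → length L ≡ suc k′ → Queue (threshold n Q) L →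
             k * P t ≤ threshold n Q → (cap - T) * ι n ≤ Q →
             After t Q (tryActive t (x t) L)
  activate {t} (mkWallet .cap o ∷ us) n Q len (refl , wait , queue) opt full
    with o ℕ.≤ᵇ t | ℕ.≤ᵇ-reflects-≤ o t | x t ≤ᵇ cap | ≤⇒≤ᵇ (x≤cap t)
  ... | true | ofʸ _ | true | _ = record
    { flushes       = n
    ; banked        = Q
    ; Q≡banked+used = cong (_+_ Q) (sym (rearrange cap (x t)))
    ; 0≤used        = ≤-trans (0≤x t) (≤-reflexive (sym (rearrange cap (x t))))
    ; queue-length  = ℕ.suc-injective len
    ; active-wait   = wait
    ; queue-wait    = queue
    ; opt-bound     = opt-bound-step n opt
    ; banked-full   = full
    }
    where
      rearrange : ∀ c v → c - (c - v) ≡ v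
      rearrange = solve-∀ ℚ-ring
  ... | false | ofⁿ offline | true | _ = record
    { flushes       = n
    ; banked        = Q
    ; Q≡banked+used = cong (_+_ Q) (sym (+-inverseʳ cap))
    ; 0≤used        = ≤-reflexive (sym (+-inverseʳ cap))
    ; queue-length  = ℕ.suc-injective len
    ; active-wait   = wait
    ; queue-wait    = queue
    ; opt-bound     = ≤-trans (wait-bound t (mkWallet cap o) wait offline)
                              (≤-reflexive (cong (threshold n) (sym (+-identityʳ Q))))
    ; banked-full   = full
    }

  flush-step : ∀ {t w ws Q} → Invariant′ t w ws Q → avail w < x t →
               After t Q (tryActive t (x t) (ws ++ [ mkWallet cap (suc (t +ℕ F)) ]))
  flush-step {t} {w} {ws} {Q} I avail<x =
    activate (ws ++ [ new ]) (suc flushes) Q length-ws++new queue′ opt′ full′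
    where
      open Invariant′ I
      new : Wallet
      new = mkWallet cap (suc (t +ℕ F))

      cap-T≤used : cap - T ≤ used w
      cap-T≤used = +-monoʳ-≤ cap (neg-antimono-≤ (≤-trans (<⇒≤ avail<x) (x≤T t)))

      length-ws++new : length (ws ++ [ new ]) ≡ suc k′
      length-ws++new = trans (List.length-++ ws) (trans (ℕ.+-comm (length ws) 1) (cong suc queue-length))

      full′ : (cap - T) * ι (suc flushes) ≤ Q
      full′ = begin
        (cap - T) * ι (suc flushes)            ≡⟨ cong ((cap - T) *_) (ι-suc flushes) ⟩
        (cap - T) * (1ℚ + ι flushes)           ≡⟨ distrib (cap - T) (ι flushes) ⟩
        (cap - T) + (cap - T) * ι flushes      ≤⟨ +-mono-≤ cap-T≤used banked-full ⟩
        used w + banked                        ≡⟨ +-comm (used w) banked ⟩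
        banked + used w                        ≡⟨ Q≡banked+used ⟨
        Q                                      ∎
        where
          open ≤-Reasoning
          distrib : ∀ a m → a * (1ℚ + m) ≡ a + a * m
          distrib = solve-∀ ℚ-ring

      opt′ : k * P t ≤ threshold (suc flushes) Q
      opt′ = ≤-trans opt-bound
               (≤-trans (p≤p+q (nonNegative⁻¹ e)) (≤-reflexive (sym (threshold-suc flushes Q))))

      queue-raised : threshold flushes banked + D ≤ threshold (suc flushes) Q
      queue-raised = begin
        threshold flushes banked + (k * (cap - T) + e)
          ≤⟨ +-monoʳ-≤ (threshold flushes banked) (+-monoˡ-≤ e (*-monoˡ-≤-nonNeg k cap-T≤used)) ⟩
        threshold flushes banked + (k * used w + e)    ≡⟨ rearrange k banked (used w) (ι flushes * e) e ⟩
        threshold flushes (banked + used w) + e        ≡⟨ cong (λ B → threshold flushes B + e) Q≡banked+used ⟨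
        threshold flushes Q + e                        ≡⟨ threshold-suc flushes Q ⟨
        threshold (suc flushes) Q                      ∎
        where
          open ≤-Reasoning
          rearrange : ∀ k b u c e → k * b + c + (k * u + e) ≡ k * (b + u) + c + e
          rearrange = solve-∀ ℚ-ring

      new-wait : WaitBound (threshold (suc flushes) Q + ι (length ws) * D) new
      new-wait = inj₂ (t , refl , (begin
        k * (C + P t)                                   ≡⟨ *-distribˡ-+ k C (P t) ⟩
        k * C + k * P t                                 ≤⟨ +-monoʳ-≤ (k * C) opt-bound ⟩
        k * C + threshold flushes Q                     ≡⟨ cong (_+ threshold flushes Q) k*C≡e+k′*D ⟩
        e + ι k′ * D + threshold flushes Q              ≡⟨ rearrange e (ι k′ * D) (threshold flushes Q) ⟩
        threshold flushes Q + e + ι k′ * D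
          ≡⟨ cong₂ (λ V m → V + ι m * D) (threshold-suc flushes Q) queue-length ⟨
        threshold (suc flushes) Q + ι (length ws) * D   ∎))
        where
          open ≤-Reasoning
          rearrange : ∀ e a b → e + a + b ≡ b + e + a
          rearrange = solve-∀ ℚ-ring

      queue′ : Queue (threshold (suc flushes) Q) (ws ++ [ new ])
      queue′ = Queue-snoc ws new (Queue-mono ws queue-raised queue-wait) refl new-wait

  step : ∀ {t v} ws Q → v ≡ x t → Invariant t ws Q → After t Q (fwfStep cap F t v ws)
  step {t} (w ∷ ws) Q refl I with onlineAt w ℕ.≤ᵇ t | ℕ.≤ᵇ-reflects-≤ (onlineAt w) t
  ... | false | ofⁿ offline = wait-step I offline
  ... | true  | ofʸ _ with x t ≤ᵇ avail w | ≤ᵇ-reflects-≤ (x t) (avail w)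
  ...   | true  | ofʸ fits  = settle-step I fits
  ...   | false | ofⁿ ¬fits = flush-step I (≰⇒> ¬fits)

  Dominated : ℕ → ℚ → Set
  Dominated t Q = ∃[ n ] k * P t ≤ threshold n Q × (cap - T) * ι n ≤ Q

  Invariant⇒Dominated : ∀ {t} ws Q → Invariant t ws Q → Dominated t Q
  Invariant⇒Dominated (w ∷ ws) Q I = flushes , opt-bound , ≤-trans banked-full banked≤Q
    where open Invariant′ I

  run : ∀ vs t ws Q → (∀ i → txAt vs i ≡ x (t +ℕ i)) → Invariant t ws Q →
        Dominated (t +ℕ length vs) (Q + fwfRun cap F t vs ws)
  run [] t ws Q _ I =
    subst₂ Dominated (sym (ℕ.+-identityʳ t)) (sym (+-identityʳ Q)) (Invariant⇒Dominated ws Q I)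
  run (v ∷ vs) t ws Q vs≡x I =
    subst₂ Dominated (sym (ℕ.+-suc t (length vs))) regroup
      (run vs (suc t) ws′ (Q + a) (λ i → trans (vs≡x (suc i)) (cong x (ℕ.+-suc t i)))
           (step ws Q (trans (vs≡x 0) (cong x (ℕ.+-identityʳ t))) I))
    where
      a : ℚ
      a = proj₁ (fwfStep cap F t v ws)
      ws′ : List Wallet
      ws′ = proj₂ (fwfStep cap F t v ws)
      regroup : Q + a + fwfRun cap F (suc t) vs ws′ ≡ Q + fwfRun cap F t (v ∷ vs) ws
      regroup = trans (+-assoc Q a _) (cong (_+_ Q) (sym (fwfRun-∷ cap F t v vs ws)))

  Dominated⇒ratio : ∀ {t Q} r → cap * r ≡ T → Dominated t Q → P t * (k * (1ℚ - r)) ≤ (1ℚ + k) * Q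
  Dominated⇒ratio {t} {Q} r cap*r≡T (n , opt , full) = *-cancelˡ-≤-pos cap {{positive 0<cap}} (begin
    cap * (P t * (k * (1ℚ - r)))                 ≡⟨ rearrange₁ cap (P t) k r ⟩
    (cap - cap * r) * (k * P t)                  ≡⟨ cong (λ s → (cap - s) * (k * P t)) cap*r≡T ⟩
    (cap - T) * (k * P t)                        ≤⟨ *-monoˡ-≤-nonNeg (cap - T) opt ⟩
    (cap - T) * (k * Q + ι n * e)                ≡⟨ rearrange₂ (cap - T) k Q (ι n) e ⟩
    k * (cap - T) * Q + e * ((cap - T) * ι n)    ≤⟨ +-monoʳ-≤ (k * (cap - T) * Q) (*-monoˡ-≤-nonNeg e full) ⟩
    k * (cap - T) * Q + e * Q                    ≡⟨ *-distribʳ-+ Q (k * (cap - T)) e ⟨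
    D * Q                                        ≡⟨ cong (_* Q) D≡[1+k]*cap-T ⟩
    ((1ℚ + k) * cap - T) * Q                     ≡⟨ rearrange₃ cap k T Q ⟩
    cap * ((1ℚ + k) * Q) - T * Q                 ≤⟨ p-q≤p (0≤p*q 0≤T 0≤Q) ⟩
    cap * ((1ℚ + k) * Q)                         ∎)
    where
      open ≤-Reasoning
      0≤Q : 0ℚ ≤ Q
      0≤Q = ≤-trans (0≤p*q (p≤q⇒0≤q-p T≤cap) (0≤ι n)) full
      rearrange₁ : ∀ c p k r → c * (p * (k * (1ℚ - r))) ≡ (c - c * r) * (k * p)
      rearrange₁ = solve-∀ ℚ-ring
      rearrange₂ : ∀ a k q m e → a * (k * q + m * e) ≡ k * a * q + e * (a * m)
      rearrange₂ = solve-∀ ℚ-ring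
      rearrange₃ : ∀ c k t q → ((1ℚ + k) * c - t) * q ≡ c * ((1ℚ + k) * q) - t * q
      rearrange₃ = solve-∀ ℚ-ring

  flushWhenFull-ratio : ∀ r → cap * r ≡ T → ∀ vs → (∀ i → txAt vs i ≡ x i) →
    P (length vs) * (k * (1ℚ - r)) ≤ (1ℚ + k) * fwfRun cap F 0 vs (replicate (suc k′) (mkWallet cap 0))
  flushWhenFull-ratio r cap*r≡T vs vs≡x = Dominated⇒ratio r cap*r≡T
    (subst (Dominated (length vs)) (+-identityˡ _) (run vs 0 _ 0ℚ vs≡x initial))

walletCap-total : ∀ C k .{{_ : ℕ.NonZero k}} → ι k * walletCap C k ≡ C
walletCap-total C k = begin
  ι k * (C * (+ 1 / k))   ≡⟨ rearrange (ι k) C (+ 1 / k) ⟩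
  C * (ι k * (+ 1 / k))   ≡⟨ cong (C *_) (ι*1/ι≡1 k) ⟩
  C * 1ℚ                  ≡⟨ *-identityʳ C ⟩
  C                       ∎
  where
    open ≡-Reasoning
    rearrange : ∀ a c b → a * (c * b) ≡ c * (a * b)
    rearrange = solve-∀ ℚ-ring

corollary1 : (C T : ℚ) (k F : ℕ) .{{_ : ℕ.NonZero k}} .{{_ : ℕ.NonZero F}} →
    (hC : 0ℚ < C) → 0ℚ < T → T < walletCap C k →
    (Tx : List ℚ) → All (λ v → 0ℚ ≤ v × v ≤ T) Tx →
    (σ : GenPolicy) → FeasibleGen C F Tx σ →
    genValue Tx σ * ((+ k / 1) * (1ℚ - _÷_ ((+ k / 1) * T) C {{>-nonZero hC}}))
      ≤ (+ (ℕ.suc k) / 1) * fwfValue C k F Tx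
corollary1 C T k@(suc k′) F 0<C 0<T T<cap Tx Tx-bounded σ feasible =
  subst (λ k+1 → genValue Tx σ * (ι k * (1ℚ - r)) ≤ k+1 * fwfValue C k F Tx) (sym (ι-suc k))
    (flushWhenFull-ratio r (*-÷-cancel cap (ι k) C T (walletCap-total C k)) Tx (λ _ → refl))
  where
    instance
      C-nonZero : NonZero C
      C-nonZero = >-nonZero 0<C
    cap : ℚ
    cap = walletCap C k
    r : ℚ
    r = (ι k * T) ÷ C
    0≤T : 0ℚ ≤ T
    0≤T = <⇒≤ 0<T
    tx-bounded : ∀ t → 0ℚ ≤ txAt Tx t × txAt Tx t ≤ T
    tx-bounded = All-txAt (≤-refl , 0≤T) Tx-bounded
    open FeasiblePolicy C F Tx σ feasible (<⇒≤ 0<C) (proj₁ ∘ tx-bounded)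
      using (settled; settled-step; settled-window)
    open FlushWhenFull C cap T k′ F (txAt Tx) settled (walletCap-total C k) (<-≤-trans 0<T (<⇒≤ T<cap))
           0≤T (<⇒≤ T<cap) (proj₁ ∘ tx-bounded) (proj₂ ∘ tx-bounded) refl settled-step settled-window
      using (flushWhenFull-ratio)
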